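{- For every integer $t\ge 1$, ${\rm im}(\mu_2(K_t))=t+1$.
   Context: For graphs $G$ and $H$, $G$ has an $H$-immersion if there is a one-to-one map $\phi:V(H)\to V(G)$ such that for each edge $uv\in E(H)$ there is a path $P_{uv}$ in $G$ joining $\phi(u)$ and $\phi(v)$, with the paths $P_{uv}$ pairwise edge-disjoint. The immersion number ${\rm im}(G)$ is the largest $t$ such that $G$ has a $K_t$-immersion. The Mycielskian $\mu_2(G)$ of a graph $G$ is the graph with vertex set $(V(G)\times\{0,1\})\cup\{w\}$ and edges $(u,0)(v,0)$, $(u,0)(v,1)$ and $(v,0)(u,1)$ for all $uv\in E(G)$, and edges $(u,1)w$ for all $u\in V(G)$. -}

module Defs where

open import Data.Nat using (ℕ; _≤_)
open import Data.Fin using (Fin)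
open import Data.Bool using (Bool; true; false)
open import Data.Product using (_×_; _,_; Σ)
open import Data.Sum using (_⊎_; inj₁; inj₂)
open import Data.Unit using (⊤; tt)
open import Data.Empty using (⊥)
open import Data.List using (List; []; _∷_)
open import Data.List.Relation.Unary.Unique.Propositional using (Unique)
open import Relation.Nullary using (¬_)
open import Relation.Binary.PropositionalEquality using (_≡_; _≢_; refl; sym)
open import Function.Definitions using (Injective)

record Graph : Set₁ where
  field
    V      : Set
    Adj    : V → V → Set
    symm   : ∀ {u v} → Adj u v → Adj v u
    irrefl : ∀ {u} → ¬ Adj u u
open Graph public

K : ℕ → Graph
K t = record
  { V = Fin t
  ; Adj = λ i j → i ≢ j
  ; symm = λ p q → p (sym q)
  ; irrefl = λ p → p refl
  }

-- Mycielskian μ₂(G): vertices (V(G) × {0,1}) ∪ {w}; false = 0, true = 1, inj₂ tt = w.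
module _ (G : Graph) where
  MV : Set
  MV = (V G × Bool) ⊎ ⊤

  MAdj : MV → MV → Set
  MAdj (inj₁ (u , false)) (inj₁ (v , false)) = Adj G u v
  MAdj (inj₁ (u , false)) (inj₁ (v , true))  = Adj G u v
  MAdj (inj₁ (u , true))  (inj₁ (v , false)) = Adj G u v
  MAdj (inj₁ (u , true))  (inj₁ (v , true))  = ⊥
  MAdj (inj₁ (u , true))  (inj₂ tt)          = ⊤
  MAdj (inj₁ (u , false)) (inj₂ tt)          = ⊥
  MAdj (inj₂ tt)          (inj₁ (v , true))  = ⊤
  MAdj (inj₂ tt)          (inj₁ (v , false)) = ⊥
  MAdj (inj₂ tt)          (inj₂ tt)          = ⊥

  MSym : ∀ {x y} → MAdj x y → MAdj y x
  MSym {inj₁ (u , false)} {inj₁ (v , false)} p = symm G p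
  MSym {inj₁ (u , false)} {inj₁ (v , true)}  p = symm G p
  MSym {inj₁ (u , true)}  {inj₁ (v , false)} p = symm G p
  MSym {inj₁ (u , true)}  {inj₂ tt}          p = tt
  MSym {inj₂ tt}          {inj₁ (v , true)}  p = tt

  MIrr : ∀ {x} → ¬ MAdj x x
  MIrr {inj₁ (u , false)} p = irrefl G p
  MIrr {inj₁ (u , true)}  ()
  MIrr {inj₂ tt}          ()

μ₂ : Graph → Graph
μ₂ G = record { V = MV G ; Adj = MAdj G ; symm = λ {x} {y} → MSym G {x} {y} ; irrefl = λ {x} → MIrr G {x} }

data Walk (G : Graph) : V G → V G → Set where
  []  : ∀ {u} → Walk G u u
  _∷_ : ∀ {u w v} → Adj G u w → Walk G w v → Walk G u v

vertices : ∀ {G u v} → Walk G u v → List (V G)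
vertices {u = u} []      = u ∷ []
vertices {u = u} (_ ∷ p) = u ∷ vertices p

IsPath : ∀ {G u v} → Walk G u v → Set
IsPath p = Unique (vertices p)

data Step {G : Graph} : ∀ {u v} → Walk G u v → V G → V G → Set where
  here  : ∀ {u w v} (e : Adj G u w) (p : Walk G w v) → Step (e ∷ p) u w
  there : ∀ {u w v a b} (e : Adj G u w) {p : Walk G w v} → Step p a b → Step (e ∷ p) a b

UsesEdge : ∀ {G u v} → Walk G u v → V G → V G → Set
UsesEdge p a b = Step p a b ⊎ Step p b a

SameEdge : {A : Set} → A → A → A → A → Set
SameEdge u v u' v' = (u ≡ u' × v ≡ v') ⊎ (u ≡ v' × v ≡ u')

record Immersion (H G : Graph) : Set where
  field
    φ        : V H → V G
    φ-inj    : Injective _≡_ _≡_ φ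
    path     : ∀ u v → Adj H u v → Walk G (φ u) (φ v)
    isPath   : ∀ u v (e : Adj H u v) → IsPath (path u v e)
    disjoint : ∀ u v u' v' (e : Adj H u v) (e' : Adj H u' v') (a b : V G) →
               UsesEdge (path u v e) a b → UsesEdge (path u' v' e') a b →
               SameEdge u v u' v'

ImmersionNumber : Graph → ℕ → Set
ImmersionNumber G m = Immersion (K m) G × (∀ s → Immersion (K s) G → s ≤ m)

-- Upper bound: a branch vertex of a K_s-immersion starts s − 1 edge-disjoint paths, so its
-- degree is at least s − 1. In μ₂(G) with |V(G)| = n, the vertices (u,1) and w have degree at
-- most n, and there are only n vertices (u,0); hence s ≥ n + 2 forces a branch vertex of degree
-- at most n, a contradiction.
-- Lower bound (t ≥ 2): take (0,1) and all (k,0) as branch vertices. Every pair is joined by an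
-- edge except (0,1),(0,0), which are joined through w and (1,1); these paths are edge-disjoint.
module Submission where

open import Defs
open import Data.Nat using (ℕ; zero; suc; _≤_; s≤s; z≤n)
open import Data.Nat.Properties using (_≤?_; ≰⇒>)
open import Data.Fin using (Fin; zero; suc; punchIn)
open import Data.Fin.Properties using (suc-injective; punchIn-injective; punchInᵢ≢i; pigeonhole; injective⇒≤; <⇒≢)
open import Data.Bool using (true; false)
open import Data.Product using (_×_; _,_; Σ; proj₁; proj₂)
open import Data.Sum using (_⊎_; inj₁; inj₂)
open import Data.Unit using (tt)
open import Data.Empty using (⊥-elim)
open import Data.List.Relation.Unary.All using ([]; _∷_)
open import Data.List.Relation.Unary.AllPairs using ([]; _∷_)
open import Relation.Binary.PropositionalEquality using (_≡_; _≢_; refl; sym; cong; subst)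
open import Relation.Nullary using (yes; no)
open import Function.Definitions using (Injective)

module _ {A : Set} where

  SameEdge-sym : ∀ {u v u' v' : A} → SameEdge u v u' v' → SameEdge u' v' u v
  SameEdge-sym (inj₁ (refl , refl)) = inj₁ (refl , refl)
  SameEdge-sym (inj₂ (refl , refl)) = inj₂ (refl , refl)

  SameEdge-trans : ∀ {u v u' v' u'' v'' : A} →
                   SameEdge u v u' v' → SameEdge u' v' u'' v'' → SameEdge u v u'' v''
  SameEdge-trans (inj₁ (refl , refl)) q                    = q
  SameEdge-trans (inj₂ (refl , refl)) (inj₁ (refl , refl)) = inj₂ (refl , refl)
  SameEdge-trans (inj₂ (refl , refl)) (inj₂ (refl , refl)) = inj₁ (refl , refl)

  Labels : A → A → A × A → Set
  Labels u v (x , y) = SameEdge u v x y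

pattern base u = inj₁ (u , false)
pattern twin u = inj₁ (u , true)
pattern apex   = inj₂ tt

first-step : ∀ {G a b} (p : Walk G a b) → a ≢ b → Σ (V G) λ y → Adj G a y × Step p a y
first-step []      a≢b = ⊥-elim (a≢b refl)
first-step (e ∷ p) _   = _ , e , here e p

module _ {G : Graph} {s : ℕ} (I : Immersion (K (suc s)) G) where
  open Immersion I

  branch-degree-bound : ∀ i {d} (enc : ∀ y → Adj G (φ i) y → Fin d) →
                        (∀ {y y'} e e' → enc y e ≡ enc y' e' → y ≡ y') → s ≤ d
  branch-degree-bound i enc enc-inj = injective⇒≤ code∘out-injective
    where
    i≢ : ∀ k → i ≢ punchIn i k
    i≢ k eq = punchInᵢ≢i i k (sym eq)

    leave : ∀ k → Σ (V G) λ y → Adj G (φ i) y × Step (path i (punchIn i k) (i≢ k)) (φ i) y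
    leave k = first-step (path i (punchIn i k) (i≢ k)) (λ eq → i≢ k (φ-inj eq))

    out : Fin s → V G
    out k = proj₁ (leave k)

    out-adj : ∀ k → Adj G (φ i) (out k)
    out-adj k = proj₁ (proj₂ (leave k))

    out-injective : Injective _≡_ _≡_ out
    out-injective {k} {k'} eq with disjoint i _ i _ (i≢ k) (i≢ k') (φ i) (out k)
                                     (inj₁ (proj₂ (proj₂ (leave k))))
                                     (inj₁ (subst (Step _ (φ i)) (sym eq) (proj₂ (proj₂ (leave k')))))
    ... | inj₁ (_ , same) = punchIn-injective i k k' same
    ... | inj₂ (_ , j≡i)  = ⊥-elim (i≢ k (sym j≡i))

    code∘out-injective : Injective _≡_ _≡_ (λ k → enc (out k) (out-adj k))
    code∘out-injective eq = out-injective (enc-inj (out-adj _) (out-adj _) eq)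

module MycielskianBound (G : Graph) {n : ℕ} (ι : V G → Fin n) (ι-inj : Injective _≡_ _≡_ ι) where

  data Extra : MV G → Set where
    extra-twin : ∀ u → Extra (twin u)
    extra-apex : Extra apex

  neighbour-code : ∀ {x} → Extra x → ∀ y → MAdj G x y → Fin n
  neighbour-code (extra-twin u) (base v) _ = ι v
  neighbour-code (extra-twin u) apex     _ = ι u
  neighbour-code extra-apex     (twin v) _ = ι v

  neighbour-code-injective : ∀ {x} (x⁺ : Extra x) {y y'} e e' →
                             neighbour-code x⁺ y e ≡ neighbour-code x⁺ y' e' → y ≡ y'
  neighbour-code-injective (extra-twin u) {base v} {base v'} _ _  eq = cong base (ι-inj eq)
  neighbour-code-injective (extra-twin u) {base v} {apex}    e _  eq = ⊥-elim (irrefl G (subst (Adj G u) (ι-inj eq) e))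
  neighbour-code-injective (extra-twin u) {apex}   {base v}  _ e' eq = ⊥-elim (irrefl G (subst (Adj G u) (ι-inj (sym eq)) e'))
  neighbour-code-injective (extra-twin u) {apex}   {apex}    _ _  _  = refl
  neighbour-code-injective extra-apex     {twin v} {twin v'} _ _  eq = cong twin (ι-inj eq)

  class : MV G → Fin (suc n)
  class (base u) = suc (ι u)
  class _        = zero

  class-collision : ∀ x y → class x ≡ class y → Extra x ⊎ x ≡ y
  class-collision (base u) (base v) eq = inj₂ (cong base (ι-inj (suc-injective eq)))
  class-collision (base u) (twin v) ()
  class-collision (base u) apex     ()
  class-collision (twin u) _        _  = inj₁ (extra-twin u)
  class-collision apex     _        _  = inj₁ extra-apex

  immersion-bound : ∀ s → Immersion (K s) (μ₂ G) → s ≤ suc n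
  immersion-bound zero    _ = z≤n
  immersion-bound (suc s) I with s ≤? n
  ... | yes s≤n = s≤s s≤n
  ... | no  s≰n with pigeonhole (s≤s (≰⇒> s≰n)) (λ i → class (Immersion.φ I i))
  ... | i , j , i<j , same with class-collision (Immersion.φ I i) (Immersion.φ I j) same
  ...   | inj₁ x⁺ = s≤s (branch-degree-bound I i (neighbour-code x⁺) (neighbour-code-injective x⁺))
  ...   | inj₂ eq = ⊥-elim (<⇒≢ i<j (Immersion.φ-inj I eq))

module _ {H G : Graph} where

  labelled-immersion :
    (φ : V H → V G) → Injective _≡_ _≡_ φ →
    (path : ∀ u v → Adj H u v → Walk G (φ u) (φ v)) → (∀ u v e → IsPath (path u v e)) →
    (label : V G → V G → V H × V H) →
    (∀ u v e a b → Step (path u v e) a b → Labels u v (label a b) × Labels u v (label b a)) →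
    Immersion H G
  labelled-immersion φ φ-inj path isPath label labelled = record
    { φ        = φ
    ; φ-inj    = φ-inj
    ; path     = path
    ; isPath   = isPath
    ; disjoint = λ u v u' v' e e' a b p p' →
                   SameEdge-trans (uses u v e a b p) (SameEdge-sym (uses u' v' e' a b p'))
    }
    where
    uses : ∀ u v e a b → UsesEdge (path u v e) a b → Labels u v (label a b)
    uses u v e a b (inj₁ st) = proj₁ (labelled u v e a b st)
    uses u v e a b (inj₂ st) = proj₂ (labelled u v e b a st)

K₂-immersion : ∀ {G x y} → Adj G x y → Immersion (K 2) G
K₂-immersion {G} {x} {y} xy = record
  { φ        = φ
  ; φ-inj    = φ-inj
  ; path     = path
  ; isPath   = isPath
  ; disjoint = λ u v u' v' e e' _ _ _ _ → K₂-edge u v u' v' e e'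
  }
  where
  φ : Fin 2 → V G
  φ zero    = x
  φ (suc _) = y

  x≢y : x ≢ y
  x≢y refl = irrefl G xy

  φ-inj : Injective _≡_ _≡_ φ
  φ-inj {zero}     {zero}     _  = refl
  φ-inj {zero}     {suc zero} eq = ⊥-elim (x≢y eq)
  φ-inj {suc zero} {zero}     eq = ⊥-elim (x≢y (sym eq))
  φ-inj {suc zero} {suc zero} _  = refl

  path : ∀ u v → u ≢ v → Walk G (φ u) (φ v)
  path zero       zero       u≢v = ⊥-elim (u≢v refl)
  path zero       (suc zero) _   = xy ∷ []
  path (suc zero) zero       _   = symm G xy ∷ []
  path (suc zero) (suc zero) u≢v = ⊥-elim (u≢v refl)

  isPath : ∀ u v (e : u ≢ v) → IsPath (path u v e)
  isPath zero       zero       u≢v = ⊥-elim (u≢v refl)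
  isPath zero       (suc zero) _   = (x≢y ∷ []) ∷ [] ∷ []
  isPath (suc zero) zero       _   = ((λ eq → x≢y (sym eq)) ∷ []) ∷ [] ∷ []
  isPath (suc zero) (suc zero) u≢v = ⊥-elim (u≢v refl)

  K₂-edge : ∀ (u v u' v' : Fin 2) → u ≢ v → u' ≢ v' → SameEdge u v u' v'
  K₂-edge zero       zero       _          _          u≢v _     = ⊥-elim (u≢v refl)
  K₂-edge (suc zero) (suc zero) _          _          u≢v _     = ⊥-elim (u≢v refl)
  K₂-edge _          _          zero       zero       _   u'≢v' = ⊥-elim (u'≢v' refl)
  K₂-edge _          _          (suc zero) (suc zero) _   u'≢v' = ⊥-elim (u'≢v' refl)
  K₂-edge zero       (suc zero) zero       (suc zero) _   _     = inj₁ (refl , refl)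
  K₂-edge zero       (suc zero) (suc zero) zero       _   _     = inj₂ (refl , refl)
  K₂-edge (suc zero) zero       zero       (suc zero) _   _     = inj₂ (refl , refl)
  K₂-edge (suc zero) zero       (suc zero) zero       _   _     = inj₁ (refl , refl)

module MycielskianCompleteImmersion (n : ℕ) where

  T : ℕ
  T = suc (suc n)

  M : Set
  M = MV (K T)

  φ : Fin (suc T) → M
  φ zero    = twin zero
  φ (suc u) = base u

  φ-inj : Injective _≡_ _≡_ φ
  φ-inj {zero}  {zero}  _    = refl
  φ-inj {suc a} {suc b} refl = refl

  path : ∀ u v → u ≢ v → Walk (μ₂ (K T)) (φ u) (φ v)
  path zero          zero          u≢v = ⊥-elim (u≢v refl)
  path zero          (suc zero)    _   = _∷_ {w = apex} tt (_∷_ {w = twin (suc zero)} tt ((λ ()) ∷ []))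
  path zero          (suc (suc k)) _   = (λ ()) ∷ []
  path (suc u)       (suc v)       u≢v = (λ eq → u≢v (cong suc eq)) ∷ []
  path (suc zero)    zero          _   = _∷_ {w = twin (suc zero)} (λ ()) (_∷_ {w = apex} tt (tt ∷ []))
  path (suc (suc k)) zero          _   = (λ ()) ∷ []

  isPath : ∀ u v (e : u ≢ v) → IsPath (path u v e)
  isPath zero          zero          u≢v = ⊥-elim (u≢v refl)
  isPath zero          (suc zero)    _   =
    ((λ ()) ∷ (λ ()) ∷ (λ ()) ∷ []) ∷ ((λ ()) ∷ (λ ()) ∷ []) ∷ ((λ ()) ∷ []) ∷ [] ∷ []
  isPath zero          (suc (suc k)) _   = ((λ ()) ∷ []) ∷ [] ∷ []
  isPath (suc u)       (suc v)       u≢v = ((λ { refl → u≢v refl }) ∷ []) ∷ [] ∷ []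
  isPath (suc zero)    zero          _   =
    ((λ ()) ∷ (λ ()) ∷ (λ ()) ∷ []) ∷ ((λ ()) ∷ (λ ()) ∷ []) ∷ ((λ ()) ∷ []) ∷ [] ∷ []
  isPath (suc (suc k)) zero          _   = ((λ ()) ∷ []) ∷ [] ∷ []

  -- Only the three edges of the detour (0,1) – w – (1,1) – (0,0) fall under the default label.
  label : M → M → Fin (suc T) × Fin (suc T)
  label (base x)    (base y)    = suc x , suc y
  label (base x)    (twin zero) = zero , suc x
  label (twin zero) (base x)    = zero , suc x
  label _           _           = zero , suc zero

  labelled : ∀ u v e a b → Step (path u v e) a b →
             Labels u v (label a b) × Labels u v (label b a)
  labelled zero          zero          u≢v _ _ _                              = ⊥-elim (u≢v refl)
  labelled zero          (suc zero)    _   _ _ (here _ _)                     = inj₁ (refl , refl) , inj₁ (refl , refl)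
  labelled zero          (suc zero)    _   _ _ (there _ (here _ _))           = inj₁ (refl , refl) , inj₁ (refl , refl)
  labelled zero          (suc zero)    _   _ _ (there _ (there _ (here _ _))) = inj₁ (refl , refl) , inj₁ (refl , refl)
  labelled zero          (suc zero)    _   _ _ (there _ (there _ (there _ ())))
  labelled zero          (suc (suc k)) _   _ _ (here _ _)                     = inj₁ (refl , refl) , inj₁ (refl , refl)
  labelled zero          (suc (suc k)) _   _ _ (there _ ())
  labelled (suc u)       (suc v)       _   _ _ (here _ _)                     = inj₁ (refl , refl) , inj₂ (refl , refl)
  labelled (suc u)       (suc v)       _   _ _ (there _ ())
  labelled (suc zero)    zero          _   _ _ (here _ _)                     = inj₂ (refl , refl) , inj₂ (refl , refl)
  labelled (suc zero)    zero          _   _ _ (there _ (here _ _))           = inj₂ (refl , refl) , inj₂ (refl , refl)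
  labelled (suc zero)    zero          _   _ _ (there _ (there _ (here _ _))) = inj₂ (refl , refl) , inj₂ (refl , refl)
  labelled (suc zero)    zero          _   _ _ (there _ (there _ (there _ ())))
  labelled (suc (suc k)) zero          _   _ _ (here _ _)                     = inj₂ (refl , refl) , inj₂ (refl , refl)
  labelled (suc (suc k)) zero          _   _ _ (there _ ())

  immersion : Immersion (K (suc T)) (μ₂ (K T))
  immersion = labelled-immersion φ φ-inj path isPath label labelled

proposition2 : ∀ (t : ℕ) → 1 ≤ t → ImmersionNumber (μ₂ (K t)) (suc t)
proposition2 t@(suc zero)    _ = K₂-immersion {μ₂ (K t)} {twin zero} {apex} tt
                               , MycielskianBound.immersion-bound (K t) (λ u → u) (λ eq → eq)
proposition2 t@(suc (suc n)) _ = MycielskianCompleteImmersion.immersion n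
                               , MycielskianBound.immersion-bound (K t) (λ u → u) (λ eq → eq)
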